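{- Let $G$ be a graph of order $n$ with $C_2(G)=n$. Then every vertex $v$ of $G$ satisfies $\deg(v)\ge n-2$.
   Context: All graphs are finite, simple and undirected. A set $S\subseteq V(G)$ is a $2$-dominating set of $G$ if every vertex of $V(G)\setminus S$ has at least $2$ neighbours in $S$. Two sets $U_1,U_2\subseteq V(G)$ form a $2$-coalition if neither $U_1$ nor $U_2$ is a $2$-dominating set of $G$, but $U_1\cup U_2$ is. A $2$-coalition partition of $G$ is a partition $\Theta$ of $V(G)$ into nonempty sets such that every set of $\Theta$ either is a $2$-dominating set of $G$ with exactly $2$ elements, or forms a $2$-coalition with some other set of $\Theta$. The $2$-coalition number $C_2(G)$ is the maximum number of sets in a $2$-coalition partition of $G$. -}

module Defs where

open import Data.Nat using (ℕ; _≤_; _∸_)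
open import Data.Bool using (Bool; true; false)
open import Data.Fin using (Fin; _≟_)
open import Data.Fin.Subset using (Subset; _∈_; _∉_; _∩_; _∪_; ∣_∣)
open import Data.Vec using (tabulate)
open import Data.Product using (Σ; ∃; _×_)
open import Data.Sum using (_⊎_)
open import Relation.Nullary using (¬_)
open import Relation.Nullary.Decidable using (⌊_⌋)
open import Relation.Binary.PropositionalEquality using (_≡_; _≢_)

record Graph (n : ℕ) : Set where
  field
    adj     : Fin n → Fin n → Bool
    sym     : ∀ u v → adj u v ≡ adj v u
    irrefl  : ∀ v → adj v v ≡ false
open Graph public

N : ∀ {n} → Graph n → Fin n → Subset n
N G v = tabulate (λ u → adj G v u)

deg : ∀ {n} → Graph n → Fin n → ℕ
deg G v = ∣ N G v ∣

Is2Dom : ∀ {n} → Graph n → Subset n → Set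
Is2Dom G S = ∀ v → v ∉ S → 2 ≤ ∣ S ∩ N G v ∣

Is2Coalition : ∀ {n} → Graph n → Subset n → Subset n → Set
Is2Coalition G U₁ U₂ = ¬ Is2Dom G U₁ × ¬ Is2Dom G U₂ × Is2Dom G (U₁ ∪ U₂)

-- A partition of V(G) = Fin n into k nonempty sets, given by a surjective
-- block-assignment p : Fin n → Fin k; block i is p⁻¹(i).
block : ∀ {n k} → (Fin n → Fin k) → Fin k → Subset n
block p i = tabulate (λ v → ⌊ p v ≟ i ⌋)

Surjective : ∀ {n k} → (Fin n → Fin k) → Set
Surjective {n} p = ∀ i → Σ (Fin n) (λ v → p v ≡ i)

Is2CoalitionPartition : ∀ {n k} → Graph n → (Fin n → Fin k) → Set
Is2CoalitionPartition {n} {k} G p =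
  Surjective p ×
  (∀ i → (Is2Dom G (block p i) × ∣ block p i ∣ ≡ 2)
         ⊎ Σ (Fin k) (λ j → j ≢ i × Is2Coalition G (block p i) (block p j)))

C₂≡ : ∀ {n} → Graph n → ℕ → Set
C₂≡ {n} G c =
  Σ (Fin n → Fin c) (λ p → Is2CoalitionPartition G p) ×
  (∀ k → (p : Fin n → Fin k) → Is2CoalitionPartition G p → k ≤ c)

-- With C₂(G) = n the partition has n nonempty blocks, so every block is a
-- singleton.  The block {v} is not a 2-dominating pair, hence it is in a
-- 2-coalition with some {w}: the pair {v, w} 2-dominates G.  A vertex u outside
-- {v, w} then has both v and w as neighbours, so v is adjacent to all vertices
-- except possibly w and itself.
module Submission where

open import Defs hiding (sym)
open import Data.Nat using (ℕ; suc; _≤_; _∸_; _+_; z≤n; s≤s)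
import Data.Nat.Properties as ℕ
open import Data.Fin using (Fin; _≟_; punchOut)
open import Data.Fin.Properties using (punchOut-injective; injective⇒≤)
open import Data.Fin.Subset using (Subset; _∈_; _∉_; _∩_; _∪_; ∣_∣; ⁅_⁆; ∁; _⊆_; inside; outside)
open import Data.Fin.Subset.Properties
  using (_∈?_; x∈⁅x⁆; x∈⁅y⁆⇒x≡y; ∣⁅x⁆∣≡1; x∈p∩q⁺; x∈p∩q⁻; x∈p∪q⁻; x∈p∪q⁺; p⊆q⇒∣p∣≤∣q∣; x∈∁p⇒x∉p; ∣∁p∣≡n∸∣p∣)
open import Data.Vec using (_∷_; []; tabulate)
open import Data.Vec.Properties using (lookup∘tabulate; []=⇒lookup; lookup⇒[]=)
open import Data.Bool using (Bool; true)
open import Data.Product using (Σ-syntax; _×_; _,_; proj₁; proj₂)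
open import Data.Sum using (inj₁; inj₂)
open import Data.Empty using (⊥-elim)
open import Function.Definitions using (Injective)
open import Relation.Nullary using (¬_; yes; no; contradiction)
open import Relation.Nullary.Decidable using (⌊_⌋)
open import Relation.Binary.PropositionalEquality
  using (_≡_; _≢_; ≢-sym; refl; sym; trans; cong; cong₂; subst)

injective⇒¬avoids : ∀ {m} {f : Fin (suc m) → Fin (suc m)} → Injective _≡_ _≡_ f →
                    ∀ z → ¬ (∀ i → f i ≢ z)
injective⇒¬avoids inj z avoids =
  ℕ.1+n≰n (injective⇒≤ {f = λ i → punchOut (≢-sym (avoids i))}
    (λ eq → inj (punchOut-injective (≢-sym (avoids _)) (≢-sym (avoids _)) eq)))

surjective⇒injective : ∀ {n} {p : Fin n → Fin n} → Surjective p → Injective _≡_ _≡_ p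
surjective⇒injective {suc _} {p} surj {x} {y} px≡py with x ≟ y
... | yes x≡y = x≡y
... | no x≢y = ⊥-elim (let z , pz≡px , sx≢z = missed in
                        injective⇒¬avoids s-injective z (s-misses z pz≡px sx≢z))
  where
  s : ∀ i → Fin _
  s i = proj₁ (surj i)

  s-injective : Injective _≡_ _≡_ s
  s-injective {i} {j} e = trans (sym (proj₂ (surj i))) (trans (cong p e) (proj₂ (surj j)))

  s-misses : ∀ z → p z ≡ p x → s (p x) ≢ z → ∀ i → s i ≢ z
  s-misses z pz≡px sx≢z i refl = sx≢z (cong s (trans (sym pz≡px) (proj₂ (surj i))))

  -- of the two distinct points x, y of the fibre over p x, at most one is s (p x)
  missed : Σ[ z ∈ Fin _ ] p z ≡ p x × s (p x) ≢ z
  missed with s (p x) ≟ x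
  ... | yes sx≡x = y , sym px≡py , λ sx≡y → x≢y (trans (sym sx≡x) sx≡y)
  ... | no sx≢x = x , refl , sx≢x

∈-tabulate⁻ : ∀ {n} {f : Fin n → Bool} {x} → x ∈ tabulate f → f x ≡ true
∈-tabulate⁻ {f = f} {x} x∈ = trans (sym (lookup∘tabulate f x)) ([]=⇒lookup x∈)

∈-tabulate⁺ : ∀ {n} {f : Fin n → Bool} {x} → f x ≡ true → x ∈ tabulate f
∈-tabulate⁺ {f = f} {x} fx = lookup⇒[]= x (tabulate f) (trans (lookup∘tabulate f x) fx)

∣p∪q∣≤∣p∣+∣q∣ : ∀ {n} (p q : Subset n) → ∣ p ∪ q ∣ ≤ ∣ p ∣ + ∣ q ∣
∣p∪q∣≤∣p∣+∣q∣ []            []            = z≤n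
∣p∪q∣≤∣p∣+∣q∣ (outside ∷ p) (outside ∷ q) = ∣p∪q∣≤∣p∣+∣q∣ p q
∣p∪q∣≤∣p∣+∣q∣ (outside ∷ p) (inside  ∷ q) =
  ℕ.≤-trans (s≤s (∣p∪q∣≤∣p∣+∣q∣ p q)) (ℕ.≤-reflexive (sym (ℕ.+-suc ∣ p ∣ ∣ q ∣)))
∣p∪q∣≤∣p∣+∣q∣ (inside  ∷ p) (outside ∷ q) = s≤s (∣p∪q∣≤∣p∣+∣q∣ p q)
∣p∪q∣≤∣p∣+∣q∣ (inside  ∷ p) (inside  ∷ q) =
  s≤s (ℕ.≤-trans (∣p∪q∣≤∣p∣+∣q∣ p q) (ℕ.+-monoʳ-≤ ∣ p ∣ (ℕ.n≤1+n ∣ q ∣)))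

∪-mono-⊆ : ∀ {n} {p p′ q q′ : Subset n} → p ⊆ p′ → q ⊆ q′ → p ∪ q ⊆ p′ ∪ q′
∪-mono-⊆ {p = p} {q = q} p⊆p′ q⊆q′ x∈ with x∈p∪q⁻ p q x∈
... | inj₁ x∈p = x∈p∪q⁺ (inj₁ (p⊆p′ x∈p))
... | inj₂ x∈q = x∈p∪q⁺ (inj₂ (q⊆q′ x∈q))

p⊆⁅x⁆⇒∣p∣≤1 : ∀ {n} {p : Subset n} {x : Fin n} → p ⊆ ⁅ x ⁆ → ∣ p ∣ ≤ 1
p⊆⁅x⁆⇒∣p∣≤1 {x = x} p⊆x = ℕ.≤-trans (p⊆q⇒∣p∣≤∣q∣ p⊆x) (ℕ.≤-reflexive (∣⁅x⁆∣≡1 x))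

∣⁅x⁆∪⁅y⁆∣≤2 : ∀ {n} (x y : Fin n) → ∣ ⁅ x ⁆ ∪ ⁅ y ⁆ ∣ ≤ 2
∣⁅x⁆∪⁅y⁆∣≤2 x y = ℕ.≤-trans (∣p∪q∣≤∣p∣+∣q∣ ⁅ x ⁆ ⁅ y ⁆) (ℕ.≤-reflexive (cong₂ _+_ (∣⁅x⁆∣≡1 x) (∣⁅x⁆∣≡1 y)))

⁅x⁆∪⁅y⁆∩p⊆⁅y⁆ : ∀ {n} {x y : Fin n} {p : Subset n} → x ∉ p → (⁅ x ⁆ ∪ ⁅ y ⁆) ∩ p ⊆ ⁅ y ⁆
⁅x⁆∪⁅y⁆∩p⊆⁅y⁆ {x = x} {y} {p} x∉p z∈ with x∈p∩q⁻ (⁅ x ⁆ ∪ ⁅ y ⁆) p z∈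
... | z∈xy , z∈p with x∈p∪q⁻ ⁅ x ⁆ ⁅ y ⁆ z∈xy
...   | inj₁ z∈x = contradiction (subst (_∈ p) (x∈⁅y⁆⇒x≡y x z∈x) z∈p) x∉p
...   | inj₂ z∈y = z∈y

block-of-injective : ∀ {n k} {p : Fin n → Fin k} → Injective _≡_ _≡_ p → ∀ v → block p (p v) ⊆ ⁅ v ⁆
block-of-injective {p = p} inj v {x} x∈ with p x ≟ p v | ∈-tabulate⁻ {f = λ u → ⌊ p u ≟ p v ⌋} x∈
... | yes px≡pv | _ rewrite inj px≡pv = x∈⁅x⁆ v

surjective⇒singleton-blocks : ∀ {n} {p : Fin n → Fin n} → Surjective p → ∀ v → block p (p v) ⊆ ⁅ v ⁆
surjective⇒singleton-blocks surj = block-of-injective (surjective⇒injective surj)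

N-sym : ∀ {n} (G : Graph n) {u v} → v ∈ N G u → u ∈ N G v
N-sym G {u} {v} v∈Nu = ∈-tabulate⁺ (trans (Graph.sym G v u) (∈-tabulate⁻ v∈Nu))

Is2Dom-mono : ∀ {n} (G : Graph n) {S T : Subset n} → S ⊆ T → Is2Dom G S → Is2Dom G T
Is2Dom-mono G {S} S⊆T S-dom u u∉T = ℕ.≤-trans (S-dom u (λ u∈S → u∉T (S⊆T u∈S))) (p⊆q⇒∣p∣≤∣q∣ S∩N⊆T∩N)
  where
  S∩N⊆T∩N : S ∩ N G u ⊆ _ ∩ N G u
  S∩N⊆T∩N x∈ with x∈p∩q⁻ S (N G u) x∈
  ... | x∈S , x∈N = x∈p∩q⁺ (S⊆T x∈S , x∈N)

Is2Dom-pair⇒adjacent : ∀ {n} (G : Graph n) {v w u : Fin n} →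
                       Is2Dom G (⁅ v ⁆ ∪ ⁅ w ⁆) → u ∉ ⁅ v ⁆ ∪ ⁅ w ⁆ → u ∈ N G v
Is2Dom-pair⇒adjacent G {v} {w} {u} pair-dom u∉ with v ∈? N G u
... | yes v∈Nu = N-sym G v∈Nu
... | no v∉Nu = contradiction
  (ℕ.≤-trans (pair-dom u u∉) (p⊆⁅x⁆⇒∣p∣≤1 (⁅x⁆∪⁅y⁆∩p⊆⁅y⁆ {y = w} v∉Nu))) ℕ.1+n≰n

Is2Dom-pair⇒deg : ∀ {n} (G : Graph n) {v w : Fin n} → Is2Dom G (⁅ v ⁆ ∪ ⁅ w ⁆) → n ∸ 2 ≤ deg G v
Is2Dom-pair⇒deg {n} G {v} {w} pair-dom = begin
  n ∸ 2                ≤⟨ ℕ.∸-monoʳ-≤ n (∣⁅x⁆∪⁅y⁆∣≤2 v w) ⟩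
  n ∸ ∣ ⁅ v ⁆ ∪ ⁅ w ⁆ ∣  ≡⟨ sym (∣∁p∣≡n∸∣p∣ (⁅ v ⁆ ∪ ⁅ w ⁆)) ⟩
  ∣ ∁ (⁅ v ⁆ ∪ ⁅ w ⁆) ∣  ≤⟨ p⊆q⇒∣p∣≤∣q∣ (λ u∈ → Is2Dom-pair⇒adjacent G pair-dom (x∈∁p⇒x∉p u∈)) ⟩
  deg G v              ∎
  where open ℕ.≤-Reasoning

theorem11 : (n : ℕ) (G : Graph n) → C₂≡ G n → (v : Fin n) → n ∸ 2 ≤ deg G v
theorem11 n G ((p , surj , cond) , _) v with cond (p v)
... | inj₁ (_ , ∣block∣≡2) =
  contradiction (ℕ.≤-trans (ℕ.≤-reflexive (sym ∣block∣≡2)) (p⊆⁅x⁆⇒∣p∣≤1 (singleton v))) ℕ.1+n≰n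
  where
  singleton : ∀ u → block p (p u) ⊆ ⁅ u ⁆
  singleton = surjective⇒singleton-blocks surj
... | inj₂ (j , _ , _ , _ , coalition-dom) with surj j
...   | w , refl =
  Is2Dom-pair⇒deg G (Is2Dom-mono G (∪-mono-⊆ (singleton v) (singleton w)) coalition-dom)
  where
  singleton : ∀ u → block p (p u) ⊆ ⁅ u ⁆
  singleton = surjective⇒singleton-blocks surj
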